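{- Let $\mathcal{P}$ be a finite poset with at least two elements that has the Unique Cover Twin Property, let $n\geq 3$, and let $\mathcal{F}\subseteq 2^{[n]}$ be induced-$\mathcal{P}$-saturated in $\mathcal{B}_n$. If there is a pair of distinct $x,y\in[n]$ such that no $F\in\mathcal{F}$ satisfies $|F\cap\{x,y\}|=1$, then $F\cap\{x,y\}=\emptyset$ for all $F\in\mathcal{F}$.
   Context: In a poset, $y$ covers $x$ if $x<y$ and there is no $z$ with $x<z<y$. A poset $\mathcal{P}=(P,\le)$ has the Unique Cover Twin Property if for every element $S\in P$ that has precisely one cover $T\in P$, there exists $S'\in P$, $S'\neq S$, such that $T$ also covers $S'$. $\mathcal{B}_n$ is the Boolean lattice $(2^{[n]},\subseteq)$. A poset $\mathcal{P}'=(P',\le')$ is an induced subposet of $\mathcal{P}=(P,\le)$ if there is an injection $f:P'\to P$ with $u\le' v$ iff $f(u)\le f(v)$. A family $\mathcal{F}\subseteq 2^{[n]}$ (ordered by inclusion) is induced-$\mathcal{P}$-saturated in $\mathcal{B}_n$ if it contains no induced copy of $\mathcal{P}$, but every $\mathcal{F}'$ with $\mathcal{F}\subsetneq\mathcal{F}'\subseteq 2^{[n]}$ contains an induced copy of $\mathcal{P}$. -}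

module Defs where

open import Data.Nat using (ℕ)
open import Data.Fin using (Fin)
open import Data.Fin.Subset using (Subset; _⊆_)
open import Data.Product using (Σ; ∃; _×_)
open import Relation.Binary.PropositionalEquality using (_≡_; _≢_)
open import Relation.Nullary using (¬_)
open import Function.Bundles using (_⇔_)

-- A finite poset is represented (up to isomorphism) by a partial order
-- relation _≤_ on Fin m (with m the number of elements).

module _ {m : ℕ} (_≤_ : Fin m → Fin m → Set) where

  _<_ : Fin m → Fin m → Set
  a < b = (a ≤ b) × (a ≢ b)

  Covers : Fin m → Fin m → Set
  Covers a b = (a < b) × ¬ (Σ (Fin m) λ z → (a < z) × (z < b))

  UCTP : Set
  UCTP = ∀ (S T : Fin m) → Covers S T → (∀ T′ → Covers S T′ → T′ ≡ T) →
         Σ (Fin m) λ S′ → (S′ ≢ S) × Covers S′ T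

Family : ℕ → Set₁
Family n = Subset n → Set

ContainsInduced : {m n : ℕ} (_≤_ : Fin m → Fin m → Set) → Family n → Set
ContainsInduced {m} {n} _≤_ G =
  Σ (Fin m → Subset n) λ f →
    (∀ u v → f u ≡ f v → u ≡ v) ×
    (∀ u → G (f u)) ×
    (∀ u v → (u ≤ v) ⇔ (f u ⊆ f v))

InducedSaturated : {m n : ℕ} (_≤_ : Fin m → Fin m → Set) → Family n → Set₁
InducedSaturated {m} {n} _≤_ F =
  ¬ ContainsInduced _≤_ F ×
  (∀ (F′ : Family n) → (∀ S → F S → F′ S) → (Σ (Subset n) λ S → F′ S × ¬ F S) →
     ContainsInduced _≤_ F′)

-- Members of F contain x iff they contain y. For a member B ∋ x the set S = B - y is
-- not in F, so F ∪ {S} contains an induced copy of P through S. Members above S lie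
-- above B, and members below B that miss x lie below S. Hence, unless the copy has a
-- member C ∋ x with C ⊂ B (to which we descend), B relates to the rest of the copy
-- exactly as S does: if B is not in the copy, replacing S by B gives a copy inside F;
-- if it is, B is the unique cover of S and S the only element covered by B, which the
-- Unique Cover Twin Property forbids. As ⊂ is well founded, no member contains x.
module Submission where

open import Defs
open import Data.Nat using (ℕ; _≤_)
open import Data.Fin using (Fin)
open import Data.Fin.Subset using (Subset; _∩_; _∪_; ⁅_⁆; ∣_∣; ⊥)
open import Data.Product using (Σ; _×_)
open import Relation.Binary.PropositionalEquality using (_≡_; _≢_)
open import Relation.Binary.Structures using (IsPartialOrder)
open import Relation.Nullary using (¬_)

open import Data.Bool.Properties using () renaming (_≟_ to _≟ᵇ_)
open import Data.Fin.Properties using (any?) renaming (_≟_ to _≟ᶠ_)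
open import Data.Fin.Subset using (_∈_; _∉_; _⊆_; _⊂_; _─_; _-_; inside; outside)
open import Data.Fin.Subset.Induction using (Acc; acc; ⊂-wellFounded)
open import Data.Fin.Subset.Properties
open import Data.Product using (∃; _,_; proj₁; proj₂)
open import Data.Sum using (_⊎_; inj₁; inj₂)
open import Data.Vec using (_∷_; here; there)
open import Data.Vec.Properties using (≡-dec)
open import Function using (_∘_; id)
open import Function.Bundles using (_⇔_; mk⇔; Equivalence)
open import Function.Properties.Equivalence using () renaming (trans to ⇔-trans)
open import Relation.Binary.Definitions using (Reflexive)
open import Relation.Binary.PropositionalEquality
  using (refl; sym; trans; cong; cong₂; subst; module ≡-Reasoning)
open import Relation.Nullary using (Dec; yes; no; contradiction)
open import Relation.Nullary.Decidable using (decidable-stable; ¬?; _×-dec_)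

private
  variable
    k : ℕ
    x y : Fin k
    p q : Subset k

_≟ˢ_ : (p q : Subset k) → Dec (p ≡ q)
_≟ˢ_ = ≡-dec _≟ᵇ_

x∈p─q⇒x∉q : x ∈ p ─ q → x ∉ q
x∈p─q⇒x∉q {p = _ ∷ p} {q = outside ∷ q} here ()
x∈p─q⇒x∉q {p = _ ∷ p} {q = outside ∷ q} (there x∈p─q) (there x∈q) = x∈p─q⇒x∉q x∈p─q x∈q
x∈p─q⇒x∉q {p = _ ∷ p} {q = inside  ∷ q} (there x∈p─q) (there x∈q) = x∈p─q⇒x∉q x∈p─q x∈q

x∉p-x : x ∉ p - x
x∉p-x {x = x} x∈p-x = x∈p─q⇒x∉q x∈p-x (x∈⁅x⁆ x)

p⊆q∧p≢q⇒p⊂q : p ⊆ q → p ≢ q → p ⊂ q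
p⊆q∧p≢q⇒p⊂q {p = p} {q} p⊆q p≢q with any? (λ i → (i ∈? q) ×-dec ¬? (i ∈? p))
... | yes (i , i∈q , i∉p) = p⊆q , i , i∈q , i∉p
... | no  ∄i = contradiction (⊆-antisym p⊆q q⊆p) p≢q
  where
  q⊆p : q ⊆ p
  q⊆p {i} i∈q = decidable-stable (i ∈? p) (λ i∉p → ∄i (i , i∈q , i∉p))

x∈p⇒p∩⁅x⁆≡⁅x⁆ : x ∈ p → p ∩ ⁅ x ⁆ ≡ ⁅ x ⁆
x∈p⇒p∩⁅x⁆≡⁅x⁆ {x = x} {p} x∈p = ⊆-antisym (p∩q⊆q p ⁅ x ⁆) ⁅x⁆⊆p∩⁅x⁆
  where
  ⁅x⁆⊆p∩⁅x⁆ : ⁅ x ⁆ ⊆ p ∩ ⁅ x ⁆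
  ⁅x⁆⊆p∩⁅x⁆ i∈⁅x⁆ with refl ← x∈⁅y⁆⇒x≡y x i∈⁅x⁆ = x∈p∩q⁺ (x∈p , i∈⁅x⁆)

x∉p⇒p∩⁅x⁆≡⊥ : x ∉ p → p ∩ ⁅ x ⁆ ≡ ⊥
x∉p⇒p∩⁅x⁆≡⊥ {x = x} {p} x∉p = Empty-unique λ where
  (i , i∈p∩⁅x⁆) → let i∈p , i∈⁅x⁆ = x∈p∩q⁻ p ⁅ x ⁆ i∈p∩⁅x⁆
                  in x∉p (subst (_∈ p) (x∈⁅y⁆⇒x≡y x i∈⁅x⁆) i∈p)

x∈p∧y∉p⇒p∩⁅x⁆∪⁅y⁆≡⁅x⁆ : x ∈ p → y ∉ p → p ∩ (⁅ x ⁆ ∪ ⁅ y ⁆) ≡ ⁅ x ⁆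
x∈p∧y∉p⇒p∩⁅x⁆∪⁅y⁆≡⁅x⁆ {x = x} {p} {y} x∈p y∉p = begin
  p ∩ (⁅ x ⁆ ∪ ⁅ y ⁆)       ≡⟨ ∩-distribˡ-∪ p ⁅ x ⁆ ⁅ y ⁆ ⟩
  p ∩ ⁅ x ⁆ ∪ p ∩ ⁅ y ⁆     ≡⟨ cong₂ _∪_ (x∈p⇒p∩⁅x⁆≡⁅x⁆ x∈p) (x∉p⇒p∩⁅x⁆≡⊥ y∉p) ⟩
  ⁅ x ⁆ ∪ ⊥                 ≡⟨ ∪-identityʳ ⁅ x ⁆ ⟩
  ⁅ x ⁆                     ∎
  where open ≡-Reasoning

x∉p∧y∉p⇒p∩⁅x⁆∪⁅y⁆≡⊥ : x ∉ p → y ∉ p → p ∩ (⁅ x ⁆ ∪ ⁅ y ⁆) ≡ ⊥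
x∉p∧y∉p⇒p∩⁅x⁆∪⁅y⁆≡⊥ {x = x} {p} {y} x∉p y∉p = begin
  p ∩ (⁅ x ⁆ ∪ ⁅ y ⁆)       ≡⟨ ∩-distribˡ-∪ p ⁅ x ⁆ ⁅ y ⁆ ⟩
  p ∩ ⁅ x ⁆ ∪ p ∩ ⁅ y ⁆     ≡⟨ cong₂ _∪_ (x∉p⇒p∩⁅x⁆≡⊥ x∉p) (x∉p⇒p∩⁅x⁆≡⊥ y∉p) ⟩
  ⊥ ∪ ⊥                     ≡⟨ ∪-identityʳ ⊥ ⟩
  ⊥                         ∎
  where open ≡-Reasoning

∣p∩⁅x⁆∪⁅y⁆∣≢1⇒x∈p⇒y∈p : ∣ p ∩ (⁅ x ⁆ ∪ ⁅ y ⁆) ∣ ≢ 1 → x ∈ p → y ∈ p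
∣p∩⁅x⁆∪⁅y⁆∣≢1⇒x∈p⇒y∈p {p = p} {x} {y} ∣p∩⁅x⁆∪⁅y⁆∣≢1 x∈p = decidable-stable (y ∈? p) λ y∉p →
  ∣p∩⁅x⁆∪⁅y⁆∣≢1 (trans (cong ∣_∣ (x∈p∧y∉p⇒p∩⁅x⁆∪⁅y⁆≡⁅x⁆ x∈p y∉p)) (∣⁅x⁆∣≡1 x))

module _ {m : ℕ} {_⊑_ : Fin m → Fin m → Set} (po : IsPartialOrder _≡_ _⊑_) where

  private
    module ⊑ = IsPartialOrder po

    _⊏_ : Fin m → Fin m → Set
    _⊏_ = _<_ _⊑_

  soleUpperCover : ∀ {u v} → u ⊏ v → (∀ w → u ⊏ w → v ⊑ w) →
                   Covers _⊑_ u v × (∀ w → Covers _⊑_ u w → w ≡ v)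
  soleUpperCover {u} {v} u⊏v v⊑above-u = (u⊏v , v-covers-u) , unique
    where
    v-covers-u : ¬ (Σ (Fin m) λ z → (u ⊏ z) × (z ⊏ v))
    v-covers-u (z , u⊏z , (z⊑v , z≢v)) = z≢v (⊑.antisym z⊑v (v⊑above-u z u⊏z))

    unique : ∀ w → Covers _⊑_ u w → w ≡ v
    unique w (u⊏w , w-covers-u) with w ≟ᶠ v
    ... | yes w≡v = w≡v
    ... | no  w≢v = contradiction (v , u⊏v , (v⊑above-u w u⊏w , w≢v ∘ sym)) w-covers-u

  UCTP⇒¬uniqueMutualCover : UCTP _⊑_ → ∀ {u v} → u ⊏ v → (∀ w → u ⊏ w → v ⊑ w) →
                            ¬ (∀ w → w ⊏ v → w ≢ u → w ⊑ u)
  UCTP⇒¬uniqueMutualCover uctp {u} {v} u⊏v v⊑above-u below-v⊑u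
    with v-covers-u , v-unique ← soleUpperCover u⊏v v⊑above-u
    with uctp u v v-covers-u v-unique
  ... | u′ , u′≢u , u′⊏v , v-covers-u′ =
    v-covers-u′ (u , (below-v⊑u u′ u′⊏v u′≢u , u′≢u) , u⊏v)

InducedCopy : {m n : ℕ} → (Fin m → Fin m → Set) → Family n → (Fin m → Subset n) → Set
InducedCopy _⊑_ G f =
  (∀ u v → f u ≡ f v → u ≡ v) × (∀ u → G (f u)) × (∀ u v → (u ⊑ v) ⇔ (f u ⊆ f v))

_[_≔_] : {m n : ℕ} → (Fin m → Subset n) → Fin m → Subset n → Fin m → Subset n
(f [ u₀ ≔ B ]) v with v ≟ᶠ u₀
... | yes _ = B
... | no  _ = f v

module _ {m n : ℕ} {_⊑_ : Fin m → Fin m → Set} (⊑-refl : Reflexive _⊑_)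
         {G : Family n} {f : Fin m → Subset n} {u₀ : Fin m} {B : Subset n} where

  InducedCopy-replace :
    (∀ u v → f u ≡ f v → u ≡ v) → (∀ u v → (u ⊑ v) ⇔ (f u ⊆ f v)) →
    G B → (∀ v → v ≢ u₀ → G (f v)) → (∀ v → f v ≢ B) →
    (∀ v → v ≢ u₀ → (f u₀ ⊆ f v) ⇔ (B ⊆ f v)) →
    (∀ v → v ≢ u₀ → (f v ⊆ f u₀) ⇔ (f v ⊆ B)) →
    InducedCopy _⊑_ G (f [ u₀ ≔ B ])
  InducedCopy-replace f-inj f-iso G-B G-f B∉f above below = inj , mem , iso
    where
    inj : ∀ u v → (f [ u₀ ≔ B ]) u ≡ (f [ u₀ ≔ B ]) v → u ≡ v
    inj u v with u ≟ᶠ u₀ | v ≟ᶠ u₀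
    ... | yes refl | yes refl = λ _ → refl
    ... | yes _    | no  _    = λ B≡fv → contradiction (sym B≡fv) (B∉f v)
    ... | no  _    | yes _    = λ fu≡B → contradiction fu≡B (B∉f u)
    ... | no  _    | no  _    = f-inj u v

    mem : ∀ u → G ((f [ u₀ ≔ B ]) u)
    mem u with u ≟ᶠ u₀
    ... | yes _   = G-B
    ... | no  u≢u₀ = G-f u u≢u₀

    iso : ∀ u v → (u ⊑ v) ⇔ ((f [ u₀ ≔ B ]) u ⊆ (f [ u₀ ≔ B ]) v)
    iso u v with u ≟ᶠ u₀ | v ≟ᶠ u₀
    ... | yes refl | yes refl = mk⇔ (λ _ {_} → id) (λ _ → ⊑-refl)
    ... | yes refl | no  v≢u₀ = ⇔-trans (f-iso u₀ v) (above v v≢u₀)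
    ... | no  u≢u₀ | yes refl = ⇔-trans (f-iso u u₀) (below u u≢u₀)
    ... | no  _    | no  _    = f-iso u v

module _ {m : ℕ} {_⊑_ : Fin m → Fin m → Set} (po : IsPartialOrder _≡_ _⊑_) (uctp : UCTP _⊑_)
         {n : ℕ} {F : Family n} (sat : InducedSaturated _⊑_ F) {x y : Fin n} (x≢y : x ≢ y)
         (x∈⇒y∈ : ∀ {A} → F A → x ∈ A → y ∈ A) (y∈⇒x∈ : ∀ {A} → F A → y ∈ A → x ∈ A) where

  private
    module ⊑ = IsPartialOrder po

    _⊏_ : Fin m → Fin m → Set
    _⊏_ = _<_ _⊑_

  module _ {B : Subset n} (F-B : F B) (x∈B : x ∈ B) where

    private
      S : Subset n
      S = B - y

      x∈S : x ∈ S
      x∈S = x∈p∧x≢y⇒x∈p-y x∈B x≢y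

      S⊂B : S ⊂ B
      S⊂B = x∈p⇒p-x⊂p (x∈⇒y∈ F-B x∈B)

      S∉F : ¬ F S
      S∉F F-S = x∉p-x (x∈⇒y∈ F-S x∈S)

      ⊇S⇒⊇B : ∀ {C} → F C → S ⊆ C → B ⊆ C
      ⊇S⇒⊇B F-C S⊆C {i} i∈B with i ≟ᶠ y
      ... | yes refl = x∈⇒y∈ F-C (S⊆C x∈S)
      ... | no  i≢y  = S⊆C (x∈p∧x≢y⇒x∈p-y i∈B i≢y)

      ⊆B∧x∉⇒⊆S : ∀ {C} → F C → C ⊆ B → x ∉ C → C ⊆ S
      ⊆B∧x∉⇒⊆S F-C C⊆B x∉C i∈C =
        x∈p∧x≢y⇒x∈p-y (C⊆B i∈C) λ { refl → x∉C (y∈⇒x∈ F-C i∈C) }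

    module _ {f : Fin m → Subset n} (f-inj : ∀ u v → f u ≡ f v → u ≡ v)
             (f-mem : ∀ u → F (f u) ⊎ f u ≡ S) (f-iso : ∀ u v → (u ⊑ v) ⇔ (f u ⊆ f v))
             {u₀ : Fin m} (fu₀≡S : f u₀ ≡ S) where

      private
        F-f : ∀ v → v ≢ u₀ → F (f v)
        F-f v v≢u₀ with f-mem v
        ... | inj₁ F-fv = F-fv
        ... | inj₂ fv≡S = contradiction (f-inj v u₀ (trans fv≡S (sym fu₀≡S))) v≢u₀

        u₀⊑⇔S⊆ : ∀ {w} → (u₀ ⊑ w) ⇔ (S ⊆ f w)
        u₀⊑⇔S⊆ {w} = subst (λ D → (u₀ ⊑ w) ⇔ (D ⊆ f w)) fu₀≡S (f-iso u₀ w)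

        ⊑u₀⇔⊆S : ∀ {w} → (w ⊑ u₀) ⇔ (f w ⊆ S)
        ⊑u₀⇔⊆S {w} = subst (λ D → (w ⊑ u₀) ⇔ (f w ⊆ D)) fu₀≡S (f-iso w u₀)

      ¬minimal : ¬ (∀ v → v ≢ u₀ → x ∈ f v → ¬ (f v ⊂ B))
      ¬minimal minimal = proj₁ sat (f [ u₀ ≔ B ] , copy)
        where
        ⊆B⇒⊆S : ∀ v → v ≢ u₀ → f v ⊆ B → f v ≢ B → f v ⊆ S
        ⊆B⇒⊆S v v≢u₀ fv⊆B fv≢B = ⊆B∧x∉⇒⊆S (F-f v v≢u₀) fv⊆B
          λ x∈fv → minimal v v≢u₀ x∈fv (p⊆q∧p≢q⇒p⊂q fv⊆B fv≢B)

        B∉f : ∀ v → f v ≢ B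
        B∉f v₁ fv₁≡B = UCTP⇒¬uniqueMutualCover po uctp u₀⊏v₁ v₁⊑above-u₀ below-v₁⊑u₀
          where
          ⊑v₁⇔⊆B : ∀ {w} → (w ⊑ v₁) ⇔ (f w ⊆ B)
          ⊑v₁⇔⊆B {w} = subst (λ D → (w ⊑ v₁) ⇔ (f w ⊆ D)) fv₁≡B (f-iso w v₁)

          u₀⊏v₁ : u₀ ⊏ v₁
          u₀⊏v₁ = Equivalence.from ⊑v₁⇔⊆B (subst (_⊆ B) (sym fu₀≡S) (proj₁ S⊂B))
                , λ { refl → ⊂-irref (trans (sym fu₀≡S) fv₁≡B) S⊂B }

          v₁⊑above-u₀ : ∀ w → u₀ ⊏ w → v₁ ⊑ w
          v₁⊑above-u₀ w (u₀⊑w , u₀≢w) = Equivalence.from (f-iso v₁ w)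
            (subst (_⊆ f w) (sym fv₁≡B)
              (⊇S⇒⊇B (F-f w (u₀≢w ∘ sym)) (Equivalence.to u₀⊑⇔S⊆ u₀⊑w)))

          below-v₁⊑u₀ : ∀ w → w ⊏ v₁ → w ≢ u₀ → w ⊑ u₀
          below-v₁⊑u₀ w (w⊑v₁ , w≢v₁) w≢u₀ = Equivalence.from ⊑u₀⇔⊆S
            (⊆B⇒⊆S w w≢u₀ (Equivalence.to ⊑v₁⇔⊆B w⊑v₁)
              λ fw≡B → w≢v₁ (f-inj w v₁ (trans fw≡B (sym fv₁≡B))))

        copy : InducedCopy _⊑_ F (f [ u₀ ≔ B ])
        copy = InducedCopy-replace ⊑.refl f-inj f-iso F-B F-f B∉f above below
          where
          S⊆⇔B⊆ : ∀ v → v ≢ u₀ → (S ⊆ f v) ⇔ (B ⊆ f v)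
          S⊆⇔B⊆ v v≢u₀ = mk⇔ (⊇S⇒⊇B (F-f v v≢u₀)) (⊆-trans (proj₁ S⊂B))

          ⊆S⇔⊆B : ∀ v → v ≢ u₀ → (f v ⊆ S) ⇔ (f v ⊆ B)
          ⊆S⇔⊆B v v≢u₀ = mk⇔ ⊆S⇒⊆B (λ fv⊆B → ⊆B⇒⊆S v v≢u₀ fv⊆B (B∉f v))
            where
            ⊆S⇒⊆B : f v ⊆ S → f v ⊆ B
            ⊆S⇒⊆B fv⊆S = ⊆-trans fv⊆S (proj₁ S⊂B)

          above : ∀ v → v ≢ u₀ → (f u₀ ⊆ f v) ⇔ (B ⊆ f v)
          above v v≢u₀ = subst (λ D → (D ⊆ f v) ⇔ (B ⊆ f v)) (sym fu₀≡S) (S⊆⇔B⊆ v v≢u₀)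

          below : ∀ v → v ≢ u₀ → (f v ⊆ f u₀) ⇔ (f v ⊆ B)
          below v v≢u₀ = subst (λ D → (f v ⊆ D) ⇔ (f v ⊆ B)) (sym fu₀≡S) (⊆S⇔⊆B v v≢u₀)

      smaller-member : ∃ λ C → F C × x ∈ C × C ⊂ B
      smaller-member with any? (λ v → ¬? (v ≟ᶠ u₀) ×-dec (x ∈? f v) ×-dec (f v ⊂? B))
      ... | yes (v , v≢u₀ , x∈fv , fv⊂B) = f v , F-f v v≢u₀ , x∈fv , fv⊂B
      ... | no  ∄smaller = contradiction
        (λ v v≢u₀ x∈fv fv⊂B → ∄smaller (v , v≢u₀ , x∈fv , fv⊂B)) ¬minimal

    shrink : ∃ λ C → F C × x ∈ C × C ⊂ B
    shrink with proj₂ sat (λ C → F C ⊎ C ≡ S) (λ _ → inj₁) (S , inj₂ refl , S∉F)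
    ... | f , f-inj , f-mem , f-iso with any? (λ u → f u ≟ˢ S)
    ... | yes (u₀ , fu₀≡S) = smaller-member f-inj f-mem f-iso fu₀≡S
    ... | no  S∉f = contradiction (f , f-inj , F-f , f-iso) (proj₁ sat)
      where
      F-f : ∀ u → F (f u)
      F-f u with f-mem u
      ... | inj₁ F-fu = F-fu
      ... | inj₂ fu≡S = contradiction (u , fu≡S) S∉f

  x∉member : ∀ {A} → F A → x ∉ A
  x∉member = go (⊂-wellFounded _)
    where
    go : ∀ {A} → Acc _⊂_ A → F A → x ∉ A
    go (acc smaller) F-A x∈A with C , F-C , x∈C , C⊂A ← shrink F-A x∈A =
      go (smaller C⊂A) F-C x∈C

lemma21 : (m : ℕ) (_⊑_ : Fin m → Fin m → Set) → IsPartialOrder _≡_ _⊑_ →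
          2 ≤ m → UCTP _⊑_ →
          (n : ℕ) → 3 ≤ n → (F : Family n) → InducedSaturated _⊑_ F →
          (x y : Fin n) → x ≢ y →
          ¬ (Σ (Subset n) λ A → F A × ∣ A ∩ (⁅ x ⁆ ∪ ⁅ y ⁆) ∣ ≡ 1) →
          ∀ (A : Subset n) → F A → A ∩ (⁅ x ⁆ ∪ ⁅ y ⁆) ≡ ⊥
lemma21 m _⊑_ po _ uctp n _ F sat x y x≢y ∄one-element-trace A F-A =
  x∉p∧y∉p⇒p∩⁅x⁆∪⁅y⁆≡⊥ x∉A (x∉A ∘ y∈⇒x∈ F-A)
  where
  x∈⇒y∈ : ∀ {A} → F A → x ∈ A → y ∈ A
  x∈⇒y∈ {A} F-A = ∣p∩⁅x⁆∪⁅y⁆∣≢1⇒x∈p⇒y∈p λ one → ∄one-element-trace (A , F-A , one)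

  y∈⇒x∈ : ∀ {A} → F A → y ∈ A → x ∈ A
  y∈⇒x∈ {A} F-A = ∣p∩⁅x⁆∪⁅y⁆∣≢1⇒x∈p⇒y∈p λ one →
    ∄one-element-trace (A , F-A , subst (λ X → ∣ A ∩ X ∣ ≡ 1) (∪-comm ⁅ y ⁆ ⁅ x ⁆) one)

  x∉A : x ∉ A
  x∉A = x∉member po uctp sat x≢y x∈⇒y∈ y∈⇒x∈ F-A
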